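{- Let $n\ge 2$ be an integer and let $(n_1,n_2)\times[k_1,k_2]$ be a partition of $n$ into two different parts, i.e. integers $n_1>n_2\ge1$, $k_1,k_2\ge1$ with $k_1n_1+k_2n_2=n$. Then there exist integers $e\ge1$, $N>s\ge1$ with $eN=n$ such that $(N,s)\times[e,0]$ is an ancestor of $(n_1,n_2)\times[k_1,k_2]$ under the extended Farey map; that is, every such partition can be obtained from the dynamics of the extended Farey map.
   Context: For integers $a_1\ge a_2\ge1$ and $c_1,c_2\ge0$, $(a_1,a_2)\times[c_1,c_2]$ denotes the partition of $c_1a_1+c_2a_2$ with $c_1$ parts $a_1$ and $c_2$ parts $a_2$. Define $\tilde F_0((a_1,a_2)\times[c_1,c_2])=(a_2,a_1-a_2)\times[c_1+c_2,c_1]$ and $\tilde F_1((a_1,a_2)\times[c_1,c_2])=(a_1-a_2,a_2)\times[c_1,c_1+c_2]$. The extended Farey map $\tilde F$ applies $\tilde F_0$ when $a_2\ge a_1-a_2$ and $\tilde F_1$ when $a_1-a_2\ge a_2$ (either one may be applied when $a_1=2a_2$). Both preserve the partitioned number. A partition $\lambda$ is an ancestor of $\mu$ (and $\mu$ a descendant of $\lambda$) if $\mu$ is obtained from $\lambda$ by finitely many applications of $\tilde F$. -}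

module Defs where

open import Data.Nat using (ℕ; _+_; _*_; _∸_; _≤_; _<_)
open import Relation.Binary.Construct.Closure.ReflexiveTransitive using (Star)

-- (a₁ , a₂) × [ c₁ , c₂ ] : the partition of c₁ a₁ + c₂ a₂ with
-- c₁ parts a₁ and c₂ parts a₂.
record Part : Set where
  constructor ⟨_,_⟩×[_,_]
  field
    a₁ a₂ c₁ c₂ : ℕ

size : Part → ℕ
size ⟨ a₁ , a₂ ⟩×[ c₁ , c₂ ] = c₁ * a₁ + c₂ * a₂

-- One application of the extended Farey map F̃.
-- Source must be a partition (1 ≤ a₂ ≤ a₁) and the image must again be a
-- partition (all parts ≥ 1), which forces a₂ < a₁.
data FareyStep : Part → Part → Set where
  step₀ : ∀ {a₁ a₂ c₁ c₂} → 1 ≤ a₂ → a₂ < a₁ → a₁ ∸ a₂ ≤ a₂ →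
          FareyStep (⟨ a₁ , a₂ ⟩×[ c₁ , c₂ ]) (⟨ a₂ , a₁ ∸ a₂ ⟩×[ c₁ + c₂ , c₁ ])
  step₁ : ∀ {a₁ a₂ c₁ c₂} → 1 ≤ a₂ → a₂ < a₁ → a₂ ≤ a₁ ∸ a₂ →
          FareyStep (⟨ a₁ , a₂ ⟩×[ c₁ , c₂ ]) (⟨ a₁ ∸ a₂ , a₂ ⟩×[ c₁ , c₁ + c₂ ])

Ancestor : Part → Part → Set
Ancestor = Star FareyStep

{-# OPTIONS --safe #-}
module Submission where

-- Run the Farey map backwards. If k₁ = k₂, then (n₁ , n₂) × [k₁ , k₁] is the
-- image of the root (n₁ + n₂ , n₁) × [k₁ , 0]. Otherwise it is the image of
-- (n₁ + n₂ , n₁) × [k₂ , k₁ − k₂] or of (n₁ + n₂ , n₂) × [k₁ , k₂ − k₁], again a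
-- partition into two different parts but with fewer parts in total, so by
-- induction on k₁ + k₂ it descends from a root. Since every step preserves the
-- partitioned number, the root (N , s) × [e , 0] satisfies e N = n.

open import Defs
open import Data.Nat using (ℕ; suc; _+_; _*_; _∸_; _≤_; _<_; s≤s; z≤n; compare; less; equal; greater)
open import Data.Nat.Induction using (<-wellFounded)
open import Data.Nat.Properties
open import Data.Nat.Solver using (module +-*-Solver)
open import Data.Product using (_×_; ∃-syntax; _,_)
open import Induction.WellFounded using (Acc; acc)
open import Relation.Binary.Construct.Closure.ReflexiveTransitive using (Star; ε; _◅_; _◅◅_)
open import Relation.Binary.PropositionalEquality
open ≡-Reasoning
open +-*-Solver

fareyStep-size : ∀ {λ′ μ} → FareyStep λ′ μ → size λ′ ≡ size μ
fareyStep-size {⟨ a₁ , a₂ ⟩×[ c₁ , c₂ ]} (step₀ _ a₂<a₁ _) = begin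
  c₁ * a₁ + c₂ * a₂                   ≡⟨ cong (λ x → c₁ * x + c₂ * a₂) (sym (m+[n∸m]≡n (<⇒≤ a₂<a₁))) ⟩
  c₁ * (a₂ + (a₁ ∸ a₂)) + c₂ * a₂     ≡⟨ solve 4 (λ c₁ c₂ a d → c₁ :* (a :+ d) :+ c₂ :* a
                                               := (c₁ :+ c₂) :* a :+ c₁ :* d) refl c₁ c₂ a₂ (a₁ ∸ a₂) ⟩
  (c₁ + c₂) * a₂ + c₁ * (a₁ ∸ a₂)     ∎
fareyStep-size {⟨ a₁ , a₂ ⟩×[ c₁ , c₂ ]} (step₁ _ a₂<a₁ _) = begin
  c₁ * a₁ + c₂ * a₂                   ≡⟨ cong (λ x → c₁ * x + c₂ * a₂) (sym (m+[n∸m]≡n (<⇒≤ a₂<a₁))) ⟩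
  c₁ * (a₂ + (a₁ ∸ a₂)) + c₂ * a₂     ≡⟨ solve 4 (λ c₁ c₂ a d → c₁ :* (a :+ d) :+ c₂ :* a
                                               := c₁ :* d :+ (c₁ :+ c₂) :* a) refl c₁ c₂ a₂ (a₁ ∸ a₂) ⟩
  c₁ * (a₁ ∸ a₂) + (c₁ + c₂) * a₂     ∎

ancestor-size : ∀ {λ′ μ} → Ancestor λ′ μ → size λ′ ≡ size μ
ancestor-size ε          = refl
ancestor-size (st ◅ sts) = trans (fareyStep-size st) (ancestor-size sts)

fareyStep₀-from-sum : ∀ {a b c d m} → 1 ≤ b → b ≤ a → c + d ≡ m →
                      FareyStep ⟨ a + b , a ⟩×[ c , d ] ⟨ a , b ⟩×[ m , c ]
fareyStep₀-from-sum {a} {b} {c} {d} 1≤b b≤a refl =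
  subst (λ x → FareyStep ⟨ a + b , a ⟩×[ c , d ] ⟨ a , x ⟩×[ c + d , c ]) (m+n∸m≡n a b)
    (step₀ (≤-trans 1≤b b≤a) (m<m+n a 1≤b) (≤-trans (≤-reflexive (m+n∸m≡n a b)) b≤a))

fareyStep₁-from-sum : ∀ {a b c d m} → 1 ≤ b → b ≤ a → c + d ≡ m →
                      FareyStep ⟨ a + b , b ⟩×[ c , d ] ⟨ a , b ⟩×[ c , m ]
fareyStep₁-from-sum {a} {b} {c} {d} 1≤b b≤a refl =
  subst (λ x → FareyStep ⟨ a + b , b ⟩×[ c , d ] ⟨ x , b ⟩×[ c , c + d ]) (m+n∸n≡m a b)
    (step₁ 1≤b (m<n+m b (≤-trans 1≤b b≤a)) (≤-trans b≤a (≤-reflexive (sym (m+n∸n≡m a b)))))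

Rooted : Part → Set
Rooted μ = ∃[ e ] ∃[ N ] ∃[ s ] (1 ≤ e × 1 ≤ s × s < N × Ancestor ⟨ N , s ⟩×[ e , 0 ] μ)

rooted-fareyStep : ∀ {λ′ μ} → Rooted λ′ → FareyStep λ′ μ → Rooted μ
rooted-fareyStep (e , N , s , 1≤e , 1≤s , s<N , anc) st = e , N , s , 1≤e , 1≤s , s<N , anc ◅◅ (st ◅ ε)

rooted-two-parts : ∀ {n₁ n₂ k₁ k₂} → Acc _<_ (k₁ + k₂) →
                   n₂ < n₁ → 1 ≤ n₂ → 1 ≤ k₁ → 1 ≤ k₂ → Rooted ⟨ n₁ , n₂ ⟩×[ k₁ , k₂ ]
rooted-two-parts {n₁} {n₂} {k₁} {k₂} (acc rs) n₂<n₁ 1≤n₂ 1≤k₁ 1≤k₂ with compare k₁ k₂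
... | equal k =
  rooted-fareyStep (k , n₁ + n₂ , n₁ , 1≤k₁ , 1≤n₁ , m<m+n n₁ 1≤n₂ , ε)
                   (fareyStep₀-from-sum 1≤n₂ (<⇒≤ n₂<n₁) (+-identityʳ k))
  where 1≤n₁ = ≤-trans 1≤n₂ (<⇒≤ n₂<n₁)
... | greater k o =
  rooted-fareyStep (rooted-two-parts (rs fewer) (m<m+n n₁ 1≤n₂) 1≤n₁ 1≤k₂ (s≤s z≤n))
                   (fareyStep₀-from-sum 1≤n₂ (<⇒≤ n₂<n₁) (+-suc k o))
  where 1≤n₁ = ≤-trans 1≤n₂ (<⇒≤ n₂<n₁)
        fewer : k + suc o < suc (k + o) + k
        fewer = subst (_< suc (k + o) + k) (sym (+-suc k o)) (m<m+n (suc (k + o)) 1≤k₂)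
... | less k o =
  rooted-fareyStep (rooted-two-parts (rs fewer) (m<n+m n₂ (≤-trans 1≤n₂ (<⇒≤ n₂<n₁))) 1≤n₂ 1≤k₁ (s≤s z≤n))
                   (fareyStep₁-from-sum 1≤n₂ (<⇒≤ n₂<n₁) (+-suc k o))
  where fewer : k + suc o < k + suc (k + o)
        fewer = subst (_< k + suc (k + o)) (sym (+-suc k o)) (m<n+m (suc (k + o)) 1≤k₁)

theorem4p19 : (n n₁ n₂ k₁ k₂ : ℕ) → 2 ≤ n → n₂ < n₁ → 1 ≤ n₂ → 1 ≤ k₁ → 1 ≤ k₂ →
    k₁ * n₁ + k₂ * n₂ ≡ n →
    ∃[ e ] ∃[ N ] ∃[ s ] (1 ≤ e × 1 ≤ s × s < N × e * N ≡ n ×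
      Ancestor (⟨ N , s ⟩×[ e , 0 ]) (⟨ n₁ , n₂ ⟩×[ k₁ , k₂ ]))
theorem4p19 _ n₁ n₂ k₁ k₂ _ n₂<n₁ 1≤n₂ 1≤k₁ 1≤k₂ refl
  with rooted-two-parts (<-wellFounded (k₁ + k₂)) n₂<n₁ 1≤n₂ 1≤k₁ 1≤k₂
... | e , N , s , 1≤e , 1≤s , s<N , anc =
  e , N , s , 1≤e , 1≤s , s<N , trans (sym (+-identityʳ (e * N))) (ancestor-size anc) , anc
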